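{- Let $m(\mathbf{x},\mathbf{y})=x^py^q\in\mathcal{O}_n$ with signed index permutation $\sigma\in B_n$. Define $\delta_i=f_i(\sigma^{ -1})$ and $\nu_i=\frac12(p_i-f_i(\sigma^{ -1}))$ for $1\le i\le n$. Then $\delta=(\delta_1,\dots,\delta_n)$ and $\nu=(\nu_1,\dots,\nu_n)$ are sequences of non-negative integers such that: (1) $p=2\nu+\delta$; (2) $\nu_1\ge\nu_2\ge\cdots\ge\nu_n$; (3) $\delta_1\ge\delta_2\ge\cdots\ge\delta_n$; (4) if $0<i<j\le n$ and $\delta_i=\delta_j$ then $\mathfrak{s}(q_i)\ge\mathfrak{s}(q_j)$.
   Context: $B_n$ is the group of bijections $\sigma$ of $\{ -n,\dots,-1,1,\dots,n\}$ with $\sigma(-k)=-\sigma(k)$. For $\tau\in B_n$: $\mathrm{Des}(\tau)=\{1\le i\le n-1:\tau(i)>\tau(i+1)\}$; $d_i(\tau)=|\{j\in\mathrm{Des}(\tau):j\ge i\}|$; $\varepsilon_i(\tau)=0$ if $\tau(i)>0$, $1$ if $\tau(i)<0$; $f_i(\tau)=2d_i(\tau)+\varepsilon_i(\tau)$. For non-negative integer sequences $p,q$, $x^py^q=\prod x_i^{p_i}y_i^{q_i}$. Let $\mathfrak{s}(a)=a$ if $a$ is even and $-a$ if $a$ is odd. $\mathcal{O}_n$ is the set of monomials $x^py^q$ with $p_k+q_k$ even for all $k$ and $(p_1,\mathfrak{s}(q_1))\ge_\ell\cdots\ge_\ell(p_n,\mathfrak{s}(q_n))$ lexicographically. The signed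 index permutation of $x^py^q\in\mathcal{O}_n$ is the unique $\sigma\in B_n$ with: (1) $q_{|\sigma(1)|}\ge\cdots\ge q_{|\sigma(n)|}$; (2) if $0<i<j$ and $q_{|\sigma(i)|}=q_{|\sigma(j)|}$ then $\sigma(i)<\sigma(i+1)<\cdots<\sigma(j)$; (3) $q_{|\sigma(i)|}$ is even iff $\sigma(i)>0$. -}

module Defs where

open import Data.Nat using (ℕ; zero; suc; _+_; _*_; _<?_)
open import Data.Nat.Properties using (<-trans; n<1+n)
open import Data.Nat.Divisibility using (_∣_)
open import Data.Bool using (Bool; true; false; if_then_else_)
open import Data.Fin using (Fin; toℕ; fromℕ<)
open import Data.Fin.Permutation using (Permutation′; _⟨$⟩ʳ_; _⟨$⟩ˡ_)
open import Data.Integer as ℤ using (ℤ; +_; -_)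
open import Data.List using (map; upTo)
open import Data.Nat.ListAction using (sum)
open import Data.Product using (_×_)
open import Data.Sum using (_⊎_)
open import Relation.Nullary using (yes; no; does)
open import Relation.Binary.PropositionalEquality using (_≡_)

-- An element of the hyperoctahedral group B_n, encoded as
--   σ(i) = ± (1 + perm(i-1))   (positions/values 1..n ↔ Fin n via i ↦ i-1),
-- the sign being negative exactly when neg (i-1) = true.
-- This is the standard bijective encoding of bijections σ of {±1..±n}
-- with σ(-k) = -σ(k): such σ is determined by its values on 1..n.
record SignedPerm (n : ℕ) : Set where
  field
    perm : Permutation′ n
    neg  : Fin n → Bool
open SignedPerm public

signed : Bool → ℕ → ℤ
signed true  k = - (+ k)
signed false k = + k

apply : ∀ {n} → SignedPerm n → Fin n → ℤ
apply σ i = signed (neg σ i) (suc (toℕ (perm σ ⟨$⟩ʳ i)))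

absIdx : ∀ {n} → SignedPerm n → Fin n → Fin n
absIdx σ i = perm σ ⟨$⟩ʳ i

inv : ∀ {n} → SignedPerm n → SignedPerm n
inv σ = record
  { perm = Data.Fin.Permutation.flip (perm σ)
  ; neg  = λ j → neg σ (perm σ ⟨$⟩ˡ j) }
  where import Data.Fin.Permutation

-- descent at 0-based position j, i.e. (j+1) ∈ Des(τ) : τ(j+1) > τ(j+2), 1 ≤ j+1 ≤ n-1
isDes : ∀ {n} → (Fin n → ℤ) → ℕ → Bool
isDes {n} τ j with suc j <? n
... | yes p = does (τ (fromℕ< p) ℤ.<? τ (fromℕ< (<-trans (n<1+n j) p)))
... | no _  = false

-- d_i(τ) = |{ j ∈ Des(τ) : j ≥ i }|  (i given 0-based)
dStat : ∀ {n} → (Fin n → ℤ) → Fin n → ℕ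
dStat {n} τ i = sum (map (λ k → if isDes τ (toℕ i + k) then 1 else 0) (upTo n))

εStat : ∀ {n} → (Fin n → ℤ) → Fin n → ℕ
εStat τ i = if does (τ i ℤ.<? + 0) then 1 else 0

fStat : ∀ {n} → SignedPerm n → Fin n → ℕ
fStat τ i = 2 * dStat (apply τ) i + εStat (apply τ) i

𝔰 : ℕ → ℤ
𝔰 a = if does (Data.Nat.Divisibility._∣?_ 2 a) then + a else - (+ a)

_≥lex_ : ℕ × ℤ → ℕ × ℤ → Set
(a Data.Product., b) ≥lex (c Data.Product., d) = (c Data.Nat.< a) ⊎ ((a ≡ c) × (d ℤ.≤ b))

InO : ∀ {n} → (p q : Fin n → ℕ) → Set
InO {n} p q =
  (∀ k → 2 ∣ (p k + q k)) ×
  (∀ (i j : Fin n) → i Data.Fin.< j → (p i Data.Product., 𝔰 (q i)) ≥lex (p j Data.Product., 𝔰 (q j)))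

IsSignedIndexPerm : ∀ {n} → (q : Fin n → ℕ) → SignedPerm n → Set
IsSignedIndexPerm {n} q σ =
  (∀ (i j : Fin n) → i Data.Fin.< j → q (absIdx σ j) Data.Nat.≤ q (absIdx σ i)) ×
  (∀ (i j : Fin n) → i Data.Fin.< j → q (absIdx σ i) ≡ q (absIdx σ j) →
     ∀ (k l : Fin n) → i Data.Fin.≤ k → k Data.Fin.< l → l Data.Fin.≤ j →
     apply σ k ℤ.< apply σ l) ×
  (∀ (i : Fin n) → (2 ∣ q (absIdx σ i) → + 0 ℤ.< apply σ i) × (+ 0 ℤ.< apply σ i → 2 ∣ q (absIdx σ i)))

module Submission where

-- Write τ = σ⁻¹. By condition (3) the sign of τ(k) is the parity of q_k, hence of p_k (as p_k + q_k is even)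
-- and of f_k(τ) = 2 d_k + ε_k, so ν_k = ⌊p_k/2⌋ − d_k. All claims then reduce to adjacent indices k, k+1,
-- where d_k = d_{k+1} + [k ∈ Des τ]. Conditions (1) and (2) say that on entries of one sign, τ has an inversion
-- exactly where 𝔰 ∘ q increases; the lexicographic order of 𝒪_n therefore forbids p_{k+1} = p_k at a descent.
-- This yields ⌊p_{k+1}/2⌋ + [k ∈ Des τ] ≤ ⌊p_k/2⌋ and (f_k, 𝔰 q_k) ≥ₗ (f_{k+1}, 𝔰 q_{k+1}), and transitivity
-- extends both from adjacent to arbitrary pairs.

open import Defs
open import Data.Bool using (Bool; true; false; not; _xor_; if_then_else_)
open import Data.Bool.Properties using (not-involutive; not-distribˡ-xor)
open import Data.Nat as ℕ using (ℕ; zero; suc; _+_; _*_; _∸_; _≤_; _<_; z≤n; s≤s; s≤s⁻¹; z<s; ⌊_/2⌋)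
open import Data.Nat.Properties
open import Data.Nat.Divisibility using (_∣_; divides; _∣?_)
open import Data.Nat.ListAction using (sum)
open import Data.Nat.ListAction.Properties using (sum-++)
open import Data.Integer as ℤ using (ℤ; +_; -_; +<+; -<-; -<+)
import Data.Integer.Properties as ℤ
open import Data.Fin as Fin using (Fin; toℕ; fromℕ; fromℕ<)
open import Data.Fin.Properties using (toℕ<n; toℕ-injective; toℕ-fromℕ; toℕ-fromℕ<; fromℕ<-toℕ; ≤fromℕ)
open import Data.Fin.Permutation using (_⟨$⟩ˡ_; inverseʳ)
open import Data.List as List using (_∷_; [_]; applyUpTo)
open import Data.List.Properties using (applyUpTo-∷ʳ; map-upTo)
open import Data.Product using (Σ; _×_; _,_; proj₁; proj₂)
open import Data.Sum using (_⊎_; inj₁; inj₂)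
open import Function using (_∘_)
open import Level using (0ℓ)
open import Relation.Binary using (Rel; Reflexive; Transitive; _⇒_)
open import Relation.Binary.PropositionalEquality using (_≡_; refl; sym; trans; cong; cong₂; subst; subst₂; module ≡-Reasoning)
open import Relation.Nullary using (¬_; yes; no; does; contradiction)
open import Relation.Nullary.Decidable using (dec-true; dec-false)

bit : Bool → ℕ
bit b = if b then 1 else 0

bit≤1 : ∀ b → bit b ≤ 1
bit≤1 true  = ≤-refl
bit≤1 false = z≤n

odd : ℕ → Bool
odd zero    = false
odd (suc m) = not (odd m)

odd-+ : ∀ m n → odd (m + n) ≡ odd m xor odd n
odd-+ zero    n = refl
odd-+ (suc m) n = trans (cong not (odd-+ m n)) (not-distribˡ-xor (odd m) (odd n))

odd-*2 : ∀ t → odd (t * 2) ≡ false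
odd-*2 zero    = refl
odd-*2 (suc t) = trans (not-involutive (odd (t * 2))) (odd-*2 t)

2*⌊n/2⌋+odd≡n : ∀ n → 2 * ⌊ n /2⌋ + bit (odd n) ≡ n
2*⌊n/2⌋+odd≡n zero          = refl
2*⌊n/2⌋+odd≡n (suc zero)    = refl
2*⌊n/2⌋+odd≡n (suc (suc n)) = begin
  2 * suc ⌊ n /2⌋ + bit (not (not (odd n))) ≡⟨ cong₂ (λ x b → x + bit b) (*-suc 2 ⌊ n /2⌋) (not-involutive (odd n)) ⟩
  2 + (2 * ⌊ n /2⌋ + bit (odd n))           ≡⟨ cong (_+_ 2) (2*⌊n/2⌋+odd≡n n) ⟩
  2 + n                                     ∎
  where open ≡-Reasoning

2∣⇒odd≡false : ∀ {n} → 2 ∣ n → odd n ≡ false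
2∣⇒odd≡false (divides t refl) = odd-*2 t

odd≡false⇒2∣ : ∀ n → odd n ≡ false → 2 ∣ n
odd≡false⇒2∣ n even = divides ⌊ n /2⌋ (begin
  n                         ≡⟨ sym (2*⌊n/2⌋+odd≡n n) ⟩
  2 * ⌊ n /2⌋ + bit (odd n) ≡⟨ cong (λ b → 2 * ⌊ n /2⌋ + bit b) even ⟩
  2 * ⌊ n /2⌋ + 0           ≡⟨ +-identityʳ _ ⟩
  2 * ⌊ n /2⌋               ≡⟨ *-comm 2 ⌊ n /2⌋ ⟩
  ⌊ n /2⌋ * 2               ∎)
  where open ≡-Reasoning

2∣m+n⇒odd≡odd : ∀ m n → 2 ∣ m + n → odd m ≡ odd n
2∣m+n⇒odd≡odd m n 2∣m+n = xor≡false⇒≡ (odd m) (odd n) (trans (sym (odd-+ m n)) (2∣⇒odd≡false 2∣m+n))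
  where
  xor≡false⇒≡ : ∀ x y → x xor y ≡ false → x ≡ y
  xor≡false⇒≡ false false _ = refl
  xor≡false⇒≡ true  true  _ = refl
  xor≡false⇒≡ false true  ()
  xor≡false⇒≡ true  false ()

2*+bit<2*suc : ∀ x b → 2 * x + bit b < 2 * suc x
2*+bit<2*suc x b = begin-strict
  2 * x + bit b ≤⟨ +-monoʳ-≤ (2 * x) (bit≤1 b) ⟩
  2 * x + 1     <⟨ +-monoʳ-< (2 * x) (s≤s (s≤s z≤n)) ⟩
  2 * x + 2     ≡⟨ +-comm (2 * x) 2 ⟩
  2 + 2 * x     ≡⟨ sym (*-suc 2 x) ⟩
  2 * suc x     ∎
  where open ≤-Reasoning

2*-cancel-≤ : ∀ {a b} c → 2 * a ≤ 2 * b + bit c → a ≤ b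
2*-cancel-≤ {a} {b} c le = s≤s⁻¹ (*-cancelˡ-< 2 a (suc b) (≤-<-trans le (2*+bit<2*suc b c)))

2*-cancel-< : ∀ {a b} c c′ → 2 * a + bit c′ < 2 * b + bit c → bit c ≤ bit c′ → a < b
2*-cancel-< {a} {b} c c′ lt c≤c′ =
  *-cancelˡ-< 2 a b (+-cancelʳ-< (bit c′) (2 * a) (2 * b) (<-≤-trans lt (+-monoʳ-≤ (2 * b) c≤c′)))

signed-suc-injective : ∀ s t {a b} → signed s (suc a) ≡ signed t (suc b) → a ≡ b
signed-suc-injective false false refl = refl
signed-suc-injective true  true  refl = refl
signed-suc-injective false true  ()
signed-suc-injective true  false ()

signed-true<false : ∀ {s t a b} → s ≡ true → t ≡ false → signed s (suc a) ℤ.< signed t (suc b)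
signed-true<false refl refl = -<+

does-signed-suc<0 : ∀ s a → does (signed s (suc a) ℤ.<? + 0) ≡ s
does-signed-suc<0 true  a = refl
does-signed-suc<0 false a = refl

𝔰≡signed-odd : ∀ a → 𝔰 a ≡ signed (odd a) a
𝔰≡signed-odd a with odd a in eq
... | false = cong (λ b → if b then + a else - + a) (dec-true (2 ∣? a) (odd≡false⇒2∣ a eq))
... | true  = cong (λ b → if b then + a else - + a)
                   (dec-false (2 ∣? a) (λ 2∣a → contradiction (trans (sym eq) (2∣⇒odd≡false 2∣a)) λ ()))

sign≡odd : ∀ s a x → (2 ∣ x → + 0 ℤ.< signed s (suc a)) → (+ 0 ℤ.< signed s (suc a) → 2 ∣ x) → s ≡ odd x
sign≡odd false a x _ pos⇒even = sym (2∣⇒odd≡false (pos⇒even (+<+ z<s)))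
sign≡odd true  a x even⇒pos _ with odd x in eq
... | true  = refl
... | false with even⇒pos (odd≡false⇒2∣ x eq)
... | ()

applyUpTo-cong : ∀ {A : Set} {f g : ℕ → A} n → (∀ j → f j ≡ g j) → applyUpTo f n ≡ applyUpTo g n
applyUpTo-cong zero    _   = refl
applyUpTo-cong (suc n) f≗g = cong₂ _∷_ (f≗g 0) (applyUpTo-cong n (f≗g ∘ suc))

sum-applyUpTo-≡0 : ∀ (g : ℕ → ℕ) n → (∀ j → g j ≡ 0) → sum (applyUpTo g n) ≡ 0
sum-applyUpTo-≡0 g zero    _   = refl
sum-applyUpTo-≡0 g (suc n) g≗0 = cong₂ _+_ (g≗0 0) (sum-applyUpTo-≡0 (g ∘ suc) n (g≗0 ∘ suc))

sum-applyUpTo-shift : ∀ (g : ℕ → ℕ) n → g n ≡ 0 → sum (applyUpTo g n) ≡ g 0 + sum (applyUpTo (g ∘ suc) n)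
sum-applyUpTo-shift g n gn≡0 = begin
  sum (applyUpTo g n)                   ≡⟨ sym (+-identityʳ _) ⟩
  sum (applyUpTo g n) + 0               ≡⟨ cong (λ x → sum (applyUpTo g n) + (x + 0)) (sym gn≡0) ⟩
  sum (applyUpTo g n) + sum [ g n ]     ≡⟨ sym (sum-++ (applyUpTo g n) [ g n ]) ⟩
  sum (applyUpTo g n List.∷ʳ g n)       ≡⟨ cong sum (applyUpTo-∷ʳ g n) ⟩
  sum (applyUpTo g (suc n))             ∎
  where open ≡-Reasoning

Adjacent : ∀ {n} → Rel (Fin n) 0ℓ
Adjacent i j = toℕ j ≡ suc (toℕ i)

adjacent⇒< : ∀ {n} {k k′ : Fin n} → Adjacent k k′ → k Fin.< k′
adjacent⇒< {k = k} adj = subst (toℕ k <_) (sym adj) (n<1+n (toℕ k))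

≤-closure : ∀ {n ℓ} (R : Rel (Fin n) ℓ) → Reflexive R → Transitive R → Adjacent ⇒ R → Fin._≤_ ⇒ R
≤-closure {n} R R-refl R-trans R-adj {i} {j} i≤j = go (toℕ j ∸ toℕ i) (sym (m∸n+n≡m i≤j))
  where
  go : ∀ δ {j} → toℕ j ≡ δ + toℕ i → R i j
  go zero    e = subst (R i) (toℕ-injective (sym e)) R-refl
  go (suc δ) {j} e = R-trans (go δ (toℕ-fromℕ< k<n)) (R-adj (trans e (cong suc (sym (toℕ-fromℕ< k<n)))))
    where
    k<n : δ + toℕ i < n
    k<n = <⇒≤ (subst (_< n) e (toℕ<n j))

to-last : ∀ {n} (k : Fin n) → Σ (Fin n) λ l → k Fin.≤ l × suc (toℕ l) ≡ n
to-last {suc m} k = fromℕ m , ≤fromℕ k , cong suc (toℕ-fromℕ m)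

≥lex-refl : Reflexive _≥lex_
≥lex-refl = inj₂ (refl , ℤ.≤-refl)

≥lex-trans : Transitive _≥lex_
≥lex-trans (inj₁ c<a)          (inj₁ e<c)          = inj₁ (<-trans e<c c<a)
≥lex-trans (inj₁ c<a)          (inj₂ (refl , _))   = inj₁ c<a
≥lex-trans (inj₂ (refl , _))   (inj₁ e<c)          = inj₁ e<c
≥lex-trans (inj₂ (refl , d≤b)) (inj₂ (refl , f≤d)) = inj₂ (refl , ℤ.≤-trans f≤d d≤b)

≥lex-2*+bit : ∀ x s s′ {y y′} → ¬ (s ≡ false × s′ ≡ true) → (s ≡ s′ → y′ ℤ.≤ y) →
  (2 * x + bit s , y) ≥lex (2 * x + bit s′ , y′)
≥lex-2*+bit x false false _   y′≤y = inj₂ (refl , y′≤y refl)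
≥lex-2*+bit x true  true  _   y′≤y = inj₂ (refl , y′≤y refl)
≥lex-2*+bit x true  false _   _    = inj₁ (+-monoʳ-< (2 * x) z<s)
≥lex-2*+bit x false true  ¬ft _    = contradiction (refl , refl) ¬ft

≥lex⇒≥ : ∀ {a b c d} → (a , b) ≥lex (c , d) → c ≤ a
≥lex⇒≥ (inj₁ c<a)        = <⇒≤ c<a
≥lex⇒≥ (inj₂ (refl , _)) = ≤-refl

≥lex-≡⇒≤ : ∀ {a b c d} → (a , b) ≥lex (c , d) → a ≡ c → d ℤ.≤ b
≥lex-≡⇒≤ (inj₁ c<a)       refl = contradiction c<a (<-irrefl refl)
≥lex-≡⇒≤ (inj₂ (_ , d≤b)) _    = d≤b

module _ {n} (τ : Fin n → ℤ) where

  isDes-beyond : ∀ {j} → n ≤ suc j → isDes τ j ≡ false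
  isDes-beyond {j} n≤1+j with suc j ℕ.<? n
  ... | yes 1+j<n = contradiction 1+j<n (≤⇒≯ n≤1+j)
  ... | no  _     = refl

  isDes-adjacent : ∀ {k k′} → Adjacent k k′ → isDes τ (toℕ k) ≡ does (τ k′ ℤ.<? τ k)
  isDes-adjacent {k} {k′} adj with suc (toℕ k) ℕ.<? n
  ... | yes k+1<n = cong₂ (λ x y → does (τ x ℤ.<? τ y))
                          (toℕ-injective (trans (toℕ-fromℕ< k+1<n) (sym adj))) (fromℕ<-toℕ k _)
  ... | no  k+1≮n = contradiction (subst (_< n) adj (toℕ<n k′)) k+1≮n

  descentBit : Fin n → Fin n → Bool
  descentBit k k′ = does (τ k′ ℤ.<? τ k)

  dStat-adjacent : ∀ {k k′} → Adjacent k k′ → dStat τ k ≡ bit (descentBit k k′) + dStat τ k′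
  dStat-adjacent {k} {k′} adj = begin
    dStat τ k                                            ≡⟨ cong sum (map-upTo (desAt k) n) ⟩
    sum (applyUpTo (desAt k) n)                          ≡⟨ sum-applyUpTo-shift (desAt k) n last-vanishes ⟩
    desAt k 0 + sum (applyUpTo (desAt k ∘ suc) n)        ≡⟨ cong₂ _+_ first (cong sum shifted) ⟩
    bit (descentBit k k′) + sum (applyUpTo (desAt k′) n) ≡⟨ cong (_+_ _) (cong sum (sym (map-upTo (desAt k′) n))) ⟩
    bit (descentBit k k′) + dStat τ k′                   ∎
    where
    open ≡-Reasoning
    desAt : Fin n → ℕ → ℕ
    desAt i j = bit (isDes τ (toℕ i + j))
    last-vanishes : desAt k n ≡ 0
    last-vanishes = cong bit (isDes-beyond (m≤n⇒m≤1+n (m≤n+m n (toℕ k))))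
    first : desAt k 0 ≡ bit (descentBit k k′)
    first = cong bit (trans (cong (isDes τ) (+-identityʳ (toℕ k))) (isDes-adjacent adj))
    shifted : applyUpTo (desAt k ∘ suc) n ≡ applyUpTo (desAt k′) n
    shifted = applyUpTo-cong n λ j → cong (bit ∘ isDes τ) (trans (+-suc (toℕ k) j) (cong (_+ j) (sym adj)))

  dStat-last : ∀ {k} → n ≤ suc (toℕ k) → dStat τ k ≡ 0
  dStat-last {k} n≤1+k = trans (cong sum (map-upTo _ n))
    (sum-applyUpTo-≡0 _ n λ j → cong bit (isDes-beyond (≤-trans n≤1+k (s≤s (m≤m+n (toℕ k) j)))))

position-order : ∀ {n} {q : Fin n → ℕ} {σ : SignedPerm n} → IsSignedIndexPerm q σ → ∀ {a b} → a Fin.< b →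
  q (absIdx σ b) < q (absIdx σ a) ⊎ (q (absIdx σ a) ≡ q (absIdx σ b) × apply σ a ℤ.< apply σ b)
position-order (decreasing , increasing , _) {a} {b} a<b with m≤n⇒m<n∨m≡n (decreasing a b a<b)
... | inj₁ lt = inj₁ lt
... | inj₂ eq = inj₂ (sym eq , increasing a b a<b (sym eq) a b ≤-refl a<b ≤-refl)

module SignedIndexPermutation {n} {p q : Fin n → ℕ} {σ : SignedPerm n}
                              (inO : InO p q) (isSIP : IsSignedIndexPerm q σ) where

  -- pos k is the position at which σ takes the value ±(k+1); σ⁻¹(k+1) = ±(pos k + 1).
  pos : Fin n → Fin n
  pos k = perm σ ⟨$⟩ˡ k

  sgn : Fin n → Bool
  sgn k = neg σ (pos k)

  τ : Fin n → ℤ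
  τ = apply (inv σ)

  d : Fin n → ℕ
  d = dStat τ

  f : Fin n → ℕ
  f = fStat (inv σ)

  h : Fin n → ℕ
  h k = ⌊ p k /2⌋

  -- ν = (p − f)/2: p and f = 2d + ε have the parity of sgn, so this is ⌊p/2⌋ − d (and d ≤ h, see d≤h).
  ν : Fin n → ℕ
  ν k = h k ∸ d k

  absIdx-pos : ∀ k → absIdx σ (pos k) ≡ k
  absIdx-pos k = inverseʳ (perm σ)

  τ-injective : ∀ {k l} → τ k ≡ τ l → k ≡ l
  τ-injective {k} {l} eq = begin
    k                ≡⟨ sym (absIdx-pos k) ⟩
    absIdx σ (pos k) ≡⟨ cong (absIdx σ) (toℕ-injective (signed-suc-injective (sgn k) (sgn l) eq)) ⟩
    absIdx σ (pos l) ≡⟨ absIdx-pos l ⟩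
    l                ∎
    where open ≡-Reasoning

  sgn≡odd-q : ∀ k → sgn k ≡ odd (q k)
  sgn≡odd-q k = subst (λ x → sgn k ≡ odd (q x)) (absIdx-pos k) (sign≡odd (sgn k) _ _ even⇒pos pos⇒even)
    where even⇒pos = proj₁ (proj₂ (proj₂ isSIP) (pos k))
          pos⇒even = proj₂ (proj₂ (proj₂ isSIP) (pos k))

  sgn≡odd-p : ∀ k → sgn k ≡ odd (p k)
  sgn≡odd-p k = trans (sgn≡odd-q k) (sym (2∣m+n⇒odd≡odd (p k) (q k) (proj₁ inO k)))

  𝔰-q : ∀ k → 𝔰 (q k) ≡ signed (sgn k) (q k)
  𝔰-q k = trans (𝔰≡signed-odd (q k)) (cong (λ s → signed s (q k)) (sym (sgn≡odd-q k)))

  p≡2h+sgn : ∀ k → p k ≡ 2 * h k + bit (sgn k)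
  p≡2h+sgn k = sym (trans (cong (λ s → 2 * h k + bit s) (sgn≡odd-p k)) (2*⌊n/2⌋+odd≡n (p k)))

  f≡2d+sgn : ∀ k → f k ≡ 2 * d k + bit (sgn k)
  f≡2d+sgn k = cong (λ s → 2 * d k + bit s) (does-signed-suc<0 (sgn k) _)

  sorted : ∀ {k l} → pos k Fin.< pos l →
    q l < q k ⊎ (q k ≡ q l × signed (sgn k) (suc (toℕ k)) ℤ.< signed (sgn l) (suc (toℕ l)))
  sorted {k} {l} lt = subst₂ Motive (absIdx-pos k) (absIdx-pos l) (position-order {q = q} {σ = σ} isSIP lt)
    where
    Motive : Fin n → Fin n → Set
    Motive x y = q y < q x ⊎ (q x ≡ q y × signed (sgn k) (suc (toℕ x)) ℤ.< signed (sgn l) (suc (toℕ y)))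

  same-sign-inversion : ∀ k l → sgn k ≡ sgn l → τ l ℤ.< τ k →
    𝔰 (q k) ℤ.< 𝔰 (q l) ⊎ (q k ≡ q l × l Fin.< k)
  same-sign-inversion k l same τl<τk =
    subst₂ (λ x y → x ℤ.< y ⊎ (q k ≡ q l × l Fin.< k)) (sym (𝔰-q k)) (sym (𝔰-q l))
      (by-sign (sgn k) (sgn l) same τl<τk (sorted {l} {k}) (sorted {k} {l}))
    where
    -- Positive entries of τ are ordered like pos, negative ones in reverse.
    by-sign : ∀ s t → s ≡ t → signed t (suc (toℕ (pos l))) ℤ.< signed s (suc (toℕ (pos k))) →
      (pos l Fin.< pos k → q k < q l ⊎ (q l ≡ q k × signed t (suc (toℕ l)) ℤ.< signed s (suc (toℕ k)))) →
      (pos k Fin.< pos l → q l < q k ⊎ (q k ≡ q l × signed s (suc (toℕ k)) ℤ.< signed t (suc (toℕ l)))) →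
      signed s (q k) ℤ.< signed t (q l) ⊎ (q k ≡ q l × l Fin.< k)
    by-sign false .false refl (+<+ (s≤s pl<pk)) l-first _ with l-first pl<pk
    ... | inj₁ qk<ql                   = inj₁ (+<+ qk<ql)
    ... | inj₂ (ql≡qk , +<+ (s≤s l<k)) = inj₂ (sym ql≡qk , l<k)
    by-sign true .true refl (-<- pk<pl) _ k-first with k-first pk<pl
    ... | inj₁ ql<qk                   = inj₁ (ℤ.neg-mono-< (+<+ ql<qk))
    ... | inj₂ (qk≡ql , -<- l<k)       = inj₂ (qk≡ql , l<k)

  inversion⇒𝔰< : ∀ {k l} → k Fin.< l → sgn k ≡ sgn l → τ l ℤ.< τ k → 𝔰 (q k) ℤ.< 𝔰 (q l)
  inversion⇒𝔰< {k} {l} k<l same τl<τk with same-sign-inversion k l same τl<τk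
  ... | inj₁ lt       = lt
  ... | inj₂ (_ , l<k) = contradiction l<k (<-asym k<l)

  ¬inversion⇒< : ∀ {k l} → k Fin.< l → ¬ (τ l ℤ.< τ k) → τ k ℤ.< τ l
  ¬inversion⇒< k<l τl≮τk = ℤ.≤∧≢⇒< (ℤ.≮⇒≥ τl≮τk) (λ eq → <⇒≢ k<l (cong toℕ (τ-injective eq)))

  ¬inversion⇒𝔰≤ : ∀ {k l} → k Fin.< l → sgn k ≡ sgn l → ¬ (τ l ℤ.< τ k) → 𝔰 (q l) ℤ.≤ 𝔰 (q k)
  ¬inversion⇒𝔰≤ {k} {l} k<l same τl≮τk with same-sign-inversion l k (sym same) (¬inversion⇒< k<l τl≮τk)
  ... | inj₁ lt         = ℤ.<⇒≤ lt
  ... | inj₂ (ql≡qk , _) = ℤ.≤-reflexive (cong 𝔰 ql≡qk)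

  inversion⇒p< : ∀ {k l} → k Fin.< l → τ l ℤ.< τ k → p l < p k
  inversion⇒p< {k} {l} k<l τl<τk with proj₂ inO k l k<l
  ... | inj₁ pl<pk            = pl<pk
  ... | inj₂ (pk≡pl , 𝔰ql≤𝔰qk) = contradiction 𝔰ql≤𝔰qk (ℤ.<⇒≱ (inversion⇒𝔰< k<l same τl<τk))
    where same = trans (sgn≡odd-p k) (trans (cong odd pk≡pl) (sym (sgn≡odd-p l)))

  inversion⇒bit≤ : ∀ k l → τ l ℤ.< τ k → bit (sgn k) ≤ bit (sgn l)
  inversion⇒bit≤ k l τl<τk with sgn k | sgn l
  ... | false | _     = z≤n
  ... | true  | true  = ≤-refl
  ... | true  | false = contradiction τl<τk (ℤ.<-asym -<+)

  d-adjacent : ∀ {k k′} → Adjacent k k′ → d k ≡ bit (descentBit τ k k′) + d k′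
  d-adjacent = dStat-adjacent τ

  h-adjacent : ∀ {k k′} → Adjacent k k′ → bit (descentBit τ k k′) + h k′ ≤ h k
  h-adjacent {k} {k′} adj with τ k′ ℤ.<? τ k
  ... | yes τk′<τk = 2*-cancel-< (sgn k) (sgn k′)
                       (subst₂ _<_ (p≡2h+sgn k′) (p≡2h+sgn k) (inversion⇒p< (adjacent⇒< adj) τk′<τk))
                       (inversion⇒bit≤ k k′ τk′<τk)
  ... | no  _      = 2*-cancel-≤ (sgn k) (begin
    2 * h k′                 ≤⟨ m≤m+n (2 * h k′) (bit (sgn k′)) ⟩
    2 * h k′ + bit (sgn k′)  ≡⟨ sym (p≡2h+sgn k′) ⟩
    p k′                     ≤⟨ ≥lex⇒≥ (proj₂ inO k k′ (adjacent⇒< adj)) ⟩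
    p k                      ≡⟨ p≡2h+sgn k ⟩
    2 * h k + bit (sgn k)    ∎)
    where open ≤-Reasoning

  d≤h-adjacent : ∀ {k k′} → Adjacent k k′ → d k′ ≤ h k′ → d k ≤ h k
  d≤h-adjacent {k} {k′} adj d≤h = begin
    d k                            ≡⟨ d-adjacent adj ⟩
    bit (descentBit τ k k′) + d k′ ≤⟨ +-monoʳ-≤ (bit (descentBit τ k k′)) d≤h ⟩
    bit (descentBit τ k k′) + h k′ ≤⟨ h-adjacent adj ⟩
    h k                            ∎
    where open ≤-Reasoning

  ν-adjacent : ∀ {k k′} → Adjacent k k′ → ν k′ ≤ ν k
  ν-adjacent {k} {k′} adj = begin
    h k′ ∸ d k′             ≡⟨ sym ([m+n]∸[m+o]≡n∸o b (h k′) (d k′)) ⟩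
    (b + h k′) ∸ (b + d k′) ≤⟨ ∸-monoˡ-≤ (b + d k′) (h-adjacent adj) ⟩
    h k ∸ (b + d k′)        ≡⟨ cong (h k ∸_) (sym (d-adjacent adj)) ⟩
    h k ∸ d k               ∎
    where
    open ≤-Reasoning
    b = bit (descentBit τ k k′)

  key-adjacent : ∀ {k k′} → Adjacent k k′ → (f k , 𝔰 (q k)) ≥lex (f k′ , 𝔰 (q k′))
  key-adjacent {k} {k′} adj rewrite f≡2d+sgn k | f≡2d+sgn k′ | d-adjacent adj with τ k′ ℤ.<? τ k
  ... | yes _      = inj₁ (<-≤-trans (2*+bit<2*suc (d k′) (sgn k′)) (m≤m+n _ (bit (sgn k))))
  ... | no  τk′≮τk = ≥lex-2*+bit (d k′) (sgn k) (sgn k′)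
                        (λ (sk , sk′) → τk′≮τk (signed-true<false sk′ sk))
                        (λ same → ¬inversion⇒𝔰≤ (adjacent⇒< adj) same τk′≮τk)

  d≤h : ∀ k → d k ≤ h k
  d≤h k with to-last k
  ... | l , k≤l , last = ≤-closure (λ i j → d j ≤ h j → d i ≤ h i) (λ le → le) (λ r s → r ∘ s) d≤h-adjacent
                           k≤l (subst (_≤ h l) (sym (dStat-last τ (≤-reflexive (sym last)))) z≤n)

  p≡2ν+f : ∀ k → p k ≡ 2 * ν k + f k
  p≡2ν+f k = begin
    p k                               ≡⟨ p≡2h+sgn k ⟩
    2 * h k + bit (sgn k)             ≡⟨ cong (λ x → 2 * x + bit (sgn k)) (sym (m∸n+n≡m (d≤h k))) ⟩
    2 * (ν k + d k) + bit (sgn k)     ≡⟨ cong (_+ bit (sgn k)) (*-distribˡ-+ 2 (ν k) (d k)) ⟩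
    2 * ν k + 2 * d k + bit (sgn k)   ≡⟨ +-assoc (2 * ν k) (2 * d k) (bit (sgn k)) ⟩
    2 * ν k + (2 * d k + bit (sgn k)) ≡⟨ cong (_+_ (2 * ν k)) (sym (f≡2d+sgn k)) ⟩
    2 * ν k + f k                     ∎
    where open ≡-Reasoning

  ν-antitone : ∀ {k l} → k Fin.≤ l → ν l ≤ ν k
  ν-antitone = ≤-closure (λ k l → ν l ≤ ν k) ≤-refl (λ r s → ≤-trans s r) ν-adjacent

  key-antitone : ∀ {k l} → k Fin.≤ l → (f k , 𝔰 (q k)) ≥lex (f l , 𝔰 (q l))
  key-antitone = ≤-closure (λ k l → (f k , 𝔰 (q k)) ≥lex (f l , 𝔰 (q l))) ≥lex-refl ≥lex-trans key-adjacent

mainTheorem5 : ∀ (n : ℕ) (p q : Fin n → ℕ) (σ : SignedPerm n) →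
    InO p q → IsSignedIndexPerm q σ →
    Σ (Fin n → ℕ) λ ν →
      (∀ i → p i ≡ 2 * ν i + fStat (inv σ) i) ×
      (∀ i j → i Fin.< j → ν j ≤ ν i) ×
      (∀ i j → i Fin.< j → fStat (inv σ) j ≤ fStat (inv σ) i) ×
      (∀ i j → i Fin.< j → fStat (inv σ) i ≡ fStat (inv σ) j → 𝔰 (q j) ℤ.≤ 𝔰 (q i))
mainTheorem5 n p q σ inO isSIP =
  ν , p≡2ν+f , (λ i j i<j → ν-antitone (<⇒≤ i<j)) ,
  (λ i j i<j → ≥lex⇒≥ (key-antitone (<⇒≤ i<j))) , (λ i j i<j → ≥lex-≡⇒≤ (key-antitone (<⇒≤ i<j)))
  where open SignedIndexPermutation {σ = σ} inO isSIP
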